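{- Let $\Gamma$ be a graph and let $G \leq \mathrm{Aut}(\Gamma)$. Suppose that $\alpha = (v_0, \ldots, v_r)$ is a $G$-consistent walk and that $\beta = (v_1, \ldots, v_{r+1})$ is a $G$-successor of $\alpha$. Then $G_\alpha$ fixes $\beta$ (i.e. fixes each of its vertices) if and only if $|\mathrm{Succ}_G((v_0, \ldots, v_r, v_{r+1}))| = 1$.
   Context: All graphs are finite and simple with at least three vertices. Automorphisms act on the right, $x \mapsto x^g$, and act on tuples of vertices coordinatewise; for a tuple $\beta$ of vertices, $G_\beta$ denotes the subgroup of $G$ fixing every entry of $\beta$. A walk of length $n \geq 1$ is a tuple $(v_0, \ldots, v_n)$ of vertices in which any two consecutive vertices are adjacent. For $G \leq \mathrm{Aut}(\Gamma)$, a walk $\alpha = (v_0, \ldots, v_n)$ is $G$-consistent if there exists $g \in G$ (a shunt of $\alpha$) with $v_i^g = v_{i+1}$ for all $i \in \{0, \ldots, n-1\}$; $\mathrm{Sh}_G(\alpha)$ is the set of such shunts. For a $G$-consistent walk $\alpha = (v_0, \ldots, v_n)$, a walk $(v_1, \ldots, v_n, v_{n+1})$ is a $G$-successor of $\alpha$ if there is $g \in \mathrm{Sh}_G(\alpha)$ with $v_n^g = v_{n+1}$; $\mathrm{Succ}_G(\alpha)$ is the set of $G$-successors of $\alpha$. (If $\beta$ is a $G$-successor of $\alpha$ as in the claim, the walk $(v_0, \ldots, v_{r+1})$ is $G$-consistent.) -}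

module Defs where

open import Data.Nat using (ℕ; zero; suc; _≤_)
open import Data.Fin using (Fin)
open import Data.Bool using (Bool; true; false; T)
open import Data.Vec using (Vec; []; _∷_; _∷ʳ_; tail; last; map)
open import Data.Product using (Σ; _×_; _,_)
open import Data.Unit using (⊤)
open import Data.Fin.Permutation using (Permutation′; _⟨$⟩ʳ_; id; flip; _∘ₚ_)
open import Relation.Binary.PropositionalEquality using (_≡_)
open import Function.Bundles using (_⇔_)

record Graph : Set where
  field
    n      : ℕ
    three≤ : 3 ≤ n
    adj    : Fin n → Fin n → Bool
    sym    : ∀ x y → adj x y ≡ adj y x
    irrefl : ∀ x → adj x x ≡ false

module _ (Γ : Graph) where
  open Graph Γ

  Vertex : Set
  Vertex = Fin n

  Adj : Vertex → Vertex → Set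
  Adj x y = T (adj x y)

  -- automorphisms act on the right: x ↦ x ^ g  (written g ⟨$⟩ʳ x)
  IsAut : Permutation′ n → Set
  IsAut g = ∀ x y → Adj x y ⇔ Adj (g ⟨$⟩ʳ x) (g ⟨$⟩ʳ y)

  -- A subgroup G ≤ Aut(Γ), given by its membership predicate.
  -- Composition g ∘ₚ h means "first g, then h" (right action).
  record Subgroup : Set₁ where
    field
      inG    : Permutation′ n → Set
      ext      : ∀ {g h} → (∀ x → g ⟨$⟩ʳ x ≡ h ⟨$⟩ʳ x) → inG g → inG h
      id∈      : inG id
      comp∈    : ∀ {g h} → inG g → inG h → inG (g ∘ₚ h)
      inv∈     : ∀ {g} → inG g → inG (flip g)
      auts     : ∀ {g} → inG g → IsAut g

  IsWalk : ∀ {m} → Vec Vertex m → Set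
  IsWalk []            = ⊤
  IsWalk (x ∷ [])      = ⊤
  IsWalk (x ∷ y ∷ vs)  = Adj x y × IsWalk (y ∷ vs)

  ShuntOf : ∀ {m} → Permutation′ n → Vec Vertex m → Set
  ShuntOf g []           = ⊤
  ShuntOf g (x ∷ [])     = ⊤
  ShuntOf g (x ∷ y ∷ vs) = (g ⟨$⟩ʳ x ≡ y) × ShuntOf g (y ∷ vs)

  module _ (G : Subgroup) where
    open Subgroup G

    -- walk of length k ≥ 1 = vector of suc (suc k') vertices
    Consistent : ∀ {k} → Vec Vertex (suc (suc k)) → Set
    Consistent α = IsWalk α × Σ (Permutation′ n) λ g → inG g × ShuntOf g α

    Succ : ∀ {k} → Vec Vertex (suc (suc k)) → Vec Vertex (suc (suc k)) → Set
    Succ α β = IsWalk β × Σ (Permutation′ n) λ g →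
                 inG g × ShuntOf g α × (β ≡ tail α ∷ʳ (g ⟨$⟩ʳ last α))

    Fixes : ∀ {m} → Permutation′ n → Vec Vertex m → Set
    Fixes g v = map (g ⟨$⟩ʳ_) v ≡ v

    StabFixes : ∀ {m k} → Vec Vertex m → Vec Vertex k → Set
    StabFixes α β = ∀ g → inG g → Fixes g α → Fixes g β

IsSingleton : {A : Set} → (A → Set) → Set
IsSingleton {A} S = Σ A λ x → S x × (∀ y → S y → y ≡ x)

{-# OPTIONS --safe #-}
module Submission where

-- The shunts of γ = (v₀, …, v_{r+1}) are exactly the h ∈ G with α^h = β, so they form the
-- coset G_α g of any one of them, g, and the successors of γ are the walks γ^h for h in that
-- coset. Hence γ has a unique successor iff every h ∈ G agreeing with g on α agrees with g on γ,
-- i.e. iff G_α fixes γ, which (as v₀ lies on α) is the same as G_α fixing β.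

open import Defs
open import Data.Nat using (ℕ; suc)
open import Data.Fin using (Fin)
open import Data.Fin.Permutation using (Permutation′; _⟨$⟩ʳ_; flip; _∘ₚ_; inverseˡ; inverseʳ)
open import Data.Vec using (Vec; []; _∷_; _∷ʳ_; head; tail; last; map)
open import Data.Vec.Properties using (∷-injective; ∷-injectiveˡ; map-∘; map-cong; map-id)
open import Data.Product using (∃-syntax; _×_; _,_; proj₁)
open import Data.Unit using (tt)
open import Function.Bundles using (_⇔_; mk⇔; Equivalence)
open import Function.Construct.Symmetry using (⇔-sym)
open import Function.Related.Propositional using (module EquationalReasoning)
open import Relation.Binary.PropositionalEquality
  using (_≡_; refl; sym; trans; cong; cong₂; module ≡-Reasoning)

open Equivalence using (to; from)

IsSingleton-image⇔ : {A B : Set} {S : B → Set} {P : A → Set} {a₀ : A} (F : A → B) →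
                     (∀ b → S b ⇔ (∃[ a ] P a × b ≡ F a)) → P a₀ →
                     IsSingleton S ⇔ (∀ a → P a → F a ≡ F a₀)
IsSingleton-image⇔ {S = S} {P} {a₀} F S⇔image Pa₀ = mk⇔ constant singleton
  where
  image : ∀ {a} → P a → S (F a)
  image {a} Pa = from (S⇔image (F a)) (a , Pa , refl)

  constant : IsSingleton S → ∀ a → P a → F a ≡ F a₀
  constant (_ , _ , unique) a Pa = trans (unique _ (image Pa)) (sym (unique _ (image Pa₀)))

  singleton : (∀ a → P a → F a ≡ F a₀) → IsSingleton S
  singleton agree = F a₀ , image Pa₀ , λ b Sb →
    let a , Pa , b≡Fa = to (S⇔image b) Sb in trans b≡Fa (agree a Pa)

module _ {n : ℕ} where

  infixl 8 _^_
  _^_ : ∀ {m} → Vec (Fin n) m → Permutation′ n → Vec (Fin n) m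
  v ^ g = map (g ⟨$⟩ʳ_) v

  module _ {m : ℕ} where

    ^-∘ₚ : ∀ (v : Vec (Fin n) m) f g → v ^ (f ∘ₚ g) ≡ v ^ f ^ g
    ^-∘ₚ v f g = map-∘ (g ⟨$⟩ʳ_) (f ⟨$⟩ʳ_) v

    ^-flip-cancelʳ : ∀ (v : Vec (Fin n) m) g → v ^ g ^ flip g ≡ v
    ^-flip-cancelʳ v g = begin
      v ^ g ^ flip g     ≡⟨ sym (^-∘ₚ v g (flip g)) ⟩
      v ^ (g ∘ₚ flip g)  ≡⟨ map-cong (λ _ → inverseˡ g) v ⟩
      map (λ x → x) v    ≡⟨ map-id v ⟩
      v                  ∎
      where open ≡-Reasoning

    ^-flip-cancelˡ : ∀ (v : Vec (Fin n) m) g → v ^ flip g ^ g ≡ v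
    ^-flip-cancelˡ v g = begin
      v ^ flip g ^ g     ≡⟨ sym (^-∘ₚ v (flip g) g) ⟩
      v ^ (flip g ∘ₚ g)  ≡⟨ map-cong (λ _ → inverseʳ g) v ⟩
      map (λ x → x) v    ≡⟨ map-id v ⟩
      v                  ∎
      where open ≡-Reasoning

    ^-injective : ∀ {v w : Vec (Fin n) m} g → v ^ g ≡ w ^ g → v ≡ w
    ^-injective {v} {w} g e = begin
      v                 ≡⟨ sym (^-flip-cancelʳ v g) ⟩
      v ^ g ^ flip g    ≡⟨ cong (_^ flip g) e ⟩
      w ^ g ^ flip g    ≡⟨ ^-flip-cancelʳ w g ⟩
      w                 ∎
      where open ≡-Reasoning

    ^-flip≡⇔ : ∀ {v w : Vec (Fin n) m} g → v ^ flip g ≡ w ⇔ v ≡ w ^ g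
    ^-flip≡⇔ {v} {w} g = mk⇔
      (λ e → trans (sym (^-flip-cancelˡ v g)) (cong (_^ g) e))
      (λ e → trans (cong (_^ flip g) e) (^-flip-cancelʳ w g))

    ^-∘ₚ-flip-fixed⇔ : ∀ (v : Vec (Fin n) m) h g → v ^ (h ∘ₚ flip g) ≡ v ⇔ v ^ h ≡ v ^ g
    ^-∘ₚ-flip-fixed⇔ v h g = mk⇔
      (λ e → to (^-flip≡⇔ g) (trans (sym (^-∘ₚ v h (flip g))) e))
      (λ e → trans (^-∘ₚ v h (flip g)) (from (^-flip≡⇔ g) e))

    ^-fixed⇔^-∘ₚ≡ : ∀ (v : Vec (Fin n) m) f g → v ^ f ≡ v ⇔ v ^ (f ∘ₚ g) ≡ v ^ g
    ^-fixed⇔^-∘ₚ≡ v f g = mk⇔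
      (λ e → trans (^-∘ₚ v f g) (cong (_^ g) e))
      (λ e → ^-injective g (trans (sym (^-∘ₚ v f g)) e))

module _ (Γ : Graph) where

  private
    V : Set
    V = Vertex Γ

  ^-walk : ∀ {m} h (v : Vec V m) → IsAut Γ h → IsWalk Γ v → IsWalk Γ (v ^ h)
  ^-walk h []           aut _       = tt
  ^-walk h (x ∷ [])     aut _       = tt
  ^-walk h (x ∷ y ∷ vs) aut (a , w) = to (aut x y) a , ^-walk h (y ∷ vs) aut w

  shunt⇒^≡ : ∀ {m} g (v : Vec V (suc m)) → ShuntOf Γ g v → v ^ g ≡ tail v ∷ʳ (g ⟨$⟩ʳ last v)
  shunt⇒^≡ g (x ∷ [])     _       = refl
  shunt⇒^≡ g (x ∷ y ∷ vs) (e , s) = cong₂ _∷_ e (shunt⇒^≡ g (y ∷ vs) s)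

  shunt-∷ʳ⇔ : ∀ {m} g x (xs : Vec V m) z → ShuntOf Γ g ((x ∷ xs) ∷ʳ z) ⇔ (x ∷ xs) ^ g ≡ xs ∷ʳ z
  shunt-∷ʳ⇔ g x []       z = mk⇔ (λ (e , _) → cong (_∷ []) e) (λ e → ∷-injectiveˡ e , tt)
  shunt-∷ʳ⇔ g x (y ∷ ys) z = mk⇔
    (λ (e , s) → cong₂ _∷_ e (to (shunt-∷ʳ⇔ g y ys z) s))
    (λ e → let e₁ , e₂ = ∷-injective e in e₁ , from (shunt-∷ʳ⇔ g y ys z) e₂)

  module _ (G : Subgroup Γ) where
    open Subgroup G

    StabFixes-∷⇔ : ∀ {m l} x (xs : Vec V m) (w : Vec V l) →
                   StabFixes Γ G (x ∷ xs) w ⇔ StabFixes Γ G (x ∷ xs) (x ∷ w)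
    StabFixes-∷⇔ x xs w = mk⇔
      (λ stab f f∈ fixed → cong₂ _∷_ (cong head fixed) (stab f f∈ fixed))
      (λ stab f f∈ fixed → cong tail (stab f f∈ fixed))

    stabiliser-coset : ∀ {m l} (u : Vec V m) (w : Vec V l) {g} → inG g →
                       StabFixes Γ G u w ⇔ (∀ h → inG h × u ^ h ≡ u ^ g → w ^ h ≡ w ^ g)
    stabiliser-coset u w {g} g∈ = mk⇔
      (λ stab h (h∈ , agree) → to (^-∘ₚ-flip-fixed⇔ w h g)
        (stab (h ∘ₚ flip g) (comp∈ h∈ (inv∈ g∈)) (from (^-∘ₚ-flip-fixed⇔ u h g) agree)))
      (λ agree f f∈ fixed → from (^-fixed⇔^-∘ₚ≡ w f g)
        (agree (f ∘ₚ g) (comp∈ f∈ g∈ , to (^-fixed⇔^-∘ₚ≡ u f g) fixed)))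

    Succ-∷ʳ⇔ : ∀ {m g} x (xs : Vec V m) z → let γ = (x ∷ xs) ∷ʳ z in
               IsWalk Γ γ → ShuntOf Γ g γ → ∀ δ →
               Succ Γ G γ δ ⇔ (∃[ h ] (inG h × (x ∷ xs) ^ h ≡ (x ∷ xs) ^ g) × δ ≡ γ ^ h)
    Succ-∷ʳ⇔ {m} {g} x xs z walk shunt δ = mk⇔
      (λ { (_ , h , h∈ , shuntₕ , refl) →
           h , (h∈ , trans (to (shunt-∷ʳ⇔ h x xs z) shuntₕ) (sym α^g)) , sym (shunt⇒^≡ h γ shuntₕ) })
      (λ { (h , (h∈ , agree) , refl) →
           let shuntₕ = from (shunt-∷ʳ⇔ h x xs z) (trans agree α^g) in
           ^-walk h γ (auts h∈) walk , h , h∈ , shuntₕ , shunt⇒^≡ h γ shuntₕ })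
      where
      γ : Vec V (suc (suc m))
      γ = (x ∷ xs) ∷ʳ z
      α^g : (x ∷ xs) ^ g ≡ xs ∷ʳ z
      α^g = to (shunt-∷ʳ⇔ g x xs z) shunt

lemma3p10 : (Γ : Graph) (G : Subgroup Γ) {k : ℕ}
    (α β : Vec (Vertex Γ) (suc (suc k))) →
    Consistent Γ G α → Succ Γ G α β →
    StabFixes Γ G α β ⇔ IsSingleton (Succ Γ G (head α ∷ β))
lemma3p10 Γ G {k} (x ∷ xs@(_ ∷ _)) _ (walkα , _) (walkβ , g , g∈ , shuntα , refl) = begin
  StabFixes Γ G α β                              ∼⟨ StabFixes-∷⇔ Γ G x xs β ⟩
  StabFixes Γ G α γ                              ∼⟨ stabiliser-coset Γ G α γ g∈ ⟩
  (∀ h → inG h × α ^ h ≡ α ^ g → γ ^ h ≡ γ ^ g)  ∼⟨ ⇔-sym (IsSingleton-image⇔ (γ ^_) successors (g∈ , refl)) ⟩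
  IsSingleton (Succ Γ G γ)                       ∎
  where
  open Subgroup G
  open EquationalReasoning
  α : Vec (Vertex Γ) (suc (suc k))
  α = x ∷ xs
  z : Vertex Γ
  z = g ⟨$⟩ʳ last α
  β : Vec (Vertex Γ) (suc (suc k))
  β = xs ∷ʳ z
  γ : Vec (Vertex Γ) (suc (suc (suc k)))
  γ = α ∷ʳ z
  shuntγ : ShuntOf Γ g γ
  shuntγ = from (shunt-∷ʳ⇔ Γ g x xs z) (shunt⇒^≡ Γ g α shuntα)
  successors : ∀ δ → Succ Γ G γ δ ⇔ (∃[ h ] (inG h × α ^ h ≡ α ^ g) × δ ≡ γ ^ h)
  successors = Succ-∷ʳ⇔ Γ G x xs z (proj₁ walkα , walkβ) shuntγ
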